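{- Let $m\ge 2$ and $n\ge 3$ be integers, and let $\mathcal{D}_m$, $\ell$ and $A(\mathcal{D}_m)$ be as defined in the context. Let $A(\mathcal{D}_m)^n$ denote the $n$-th $(\min,+)$ power of $A(\mathcal{D}_m)$. Then $$\min_{i} \big(A(\mathcal{D}_m)^n\big)_{ii} = \gamma_2(P_m\Box C_n),$$ where the minimum runs over all diagonal entries (i.e. over all vertices of $\mathcal{D}_m$).
   Context: $P_m$ is the path on $m$ vertices and $C_n$ the cycle on $n$ vertices. The Cartesian product $G\Box H$ has vertex set $V(G)\times V(H)$, with $(g_1,h_1)\sim(g_2,h_2)$ iff either $g_1=g_2$ and $h_1h_2\in E(H)$, or $g_1g_2\in E(G)$ and $h_1=h_2$. A $2$-dominating set of a graph $G$ is a set $S\subseteq V(G)$ such that every vertex not in $S$ has at least two neighbours in $S$; $\gamma_2(G)$ is the minimum cardinality of a $2$-dominating set. A correct $m$-word is a word $p=(p_1,\dots,p_m)$ over the alphabet $\{0,1,2\}$ that contains none of $020,111,211,112,212$ as a block of consecutive letters, whose first two letters $p_1p_2$ are neither $11$ nor $12$, and whose last two letters $p_{m-1}p_m$ are neither $11$ nor $21$. For correct $m$-words $q,p$, say that $p$ can follow $q$ if for every $i\in\{1,\dots,m\}$: (i) if $q_i=2$ then $p_i=0$; (ii) if $p_i=2$ then exactly one of $p_{i-1},p_{i+1},q_i$ equals $0$; (iii) if $p_i=1$ then at least two of $p_{i-1},p_{i+1},q_i$ equal $0$; here letters with index $0$ or $m+1$ are simply omitted from the lists in (ii) and (iii). The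 digraph $\mathcal{D}_m$ has as vertices all correct $m$-words, with an arc from $q$ to $p$ iff $p$ can follow $q$. The label of the arc $(q,p)$ is $\ell(q,p)=$ the number of letters $0$ in $p$. $A(\mathcal{D}_m)$ is the square matrix indexed by the vertices of $\mathcal{D}_m$ with $A(\mathcal{D}_m)_{qp}=\ell(q,p)$ if $(q,p)$ is an arc of $\mathcal{D}_m$ and $A(\mathcal{D}_m)_{qp}=\infty$ otherwise. Matrices are over the tropical semiring $(\mathbb{R}\cup\{\infty\},\min,+)$: the $(\min,+)$ product is $(A\boxtimes B)_{ij}=\min_k (a_{ik}+b_{kj})$, and $M^n$ is the $n$-fold $(\min,+)$ product of $M$ with itself. -}

module Defs where

open import Data.Nat using (ℕ; zero; suc; _+_; _≤_; _∸_; _≡ᵇ_)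
open import Data.Bool using (Bool; true; false; _∧_; _∨_; not; if_then_else_; T)
open import Data.Bool.Properties using (T?)
open import Data.Maybe using (Maybe; just; nothing)
open import Data.List using (List; []; _∷_; foldr; map; concatMap; reverse; mapMaybe; allFin)
open import Data.Nat.ListAction using (sum)
open import Data.Vec using (Vec; toList)
import Data.Vec as Vec
open import Data.Fin using (Fin; toℕ)
open import Data.Product using (Σ; _×_; _,_)
open import Relation.Nullary using (yes; no)
open import Relation.Binary.PropositionalEquality using (_≡_)

ℕ∞ : Set
ℕ∞ = Maybe ℕ

∞ : ℕ∞
∞ = nothing

min∞ : ℕ∞ → ℕ∞ → ℕ∞
min∞ nothing y = y
min∞ x nothing = x
min∞ (just a) (just b) = just (Data.Nat._⊓_ a b)

_+∞_ : ℕ∞ → ℕ∞ → ℕ∞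
just a +∞ just b = just (a + b)
_ +∞ _ = nothing

data Letter : Set where
  l0 l1 l2 : Letter

is0 is1 is2 : Letter → Bool
is0 l0 = true
is0 _  = false
is1 l1 = true
is1 _  = false
is2 l2 = true
is2 _  = false

Word : ℕ → Set
Word m = Vec Letter m

allWords : (m : ℕ) → List (Word m)
allWords zero = Vec.[] ∷ []
allWords (suc m) = concatMap (λ w → (l0 Vec.∷ w) ∷ (l1 Vec.∷ w) ∷ (l2 Vec.∷ w) ∷ []) (allWords m)

badBlock : Letter → Letter → Letter → Bool
badBlock l0 l2 l0 = true
badBlock l1 l1 l1 = true
badBlock l2 l1 l1 = true
badBlock l1 l1 l2 = true
badBlock l2 l1 l2 = true
badBlock _  _  _  = false

noBadBlock : List Letter → Bool
noBadBlock (a ∷ b ∷ c ∷ r) = not (badBlock a b c) ∧ noBadBlock (b ∷ c ∷ r)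
noBadBlock _ = true

startOK : List Letter → Bool
startOK (a ∷ b ∷ _) = not (is1 a ∧ (is1 b ∨ is2 b))
startOK _ = true

-- last two letters p_{m-1} p_m are neither 11 nor 21, i.e. the reversed
-- word p_m p_{m-1} ... does not start with 11 or 12
endOK : List Letter → Bool
endOK w = startOK (reverse w)

correct : {m : ℕ} → Word m → Bool
correct w = noBadBlock (toList w) ∧ startOK (toList w) ∧ endOK (toList w)

zeroCount : Maybe Letter → ℕ
zeroCount (just l0) = 1
zeroCount _ = 0

headM : List Letter → Maybe Letter
headM [] = nothing
headM (x ∷ _) = just x

-- local condition at one position i: prev = p_{i-1}, next = p_{i+1}
-- (nothing when the index is 0 or m+1), qi = q_i, pi = p_i
localOK : Maybe Letter → Maybe Letter → Letter → Letter → Bool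
localOK prev next qi pi =
  (not (is2 qi) ∨ is0 pi)
  ∧ (not (is2 pi) ∨ (z ≡ᵇ 1))
  ∧ (not (is1 pi) ∨ (2 Data.Nat.≤ᵇ z))
  where
  z : ℕ
  z = zeroCount prev + zeroCount next + zeroCount (just qi)

followsL : Maybe Letter → List Letter → List Letter → Bool
followsL prev (qi ∷ qs) (pi ∷ ps) = localOK prev (headM ps) qi pi ∧ followsL (just pi) qs ps
followsL _ _ _ = true

canFollow : {m : ℕ} → Word m → Word m → Bool   -- canFollow q p : p can follow q
canFollow q p = followsL nothing (toList q) (toList p)

numZeros : {m : ℕ} → Word m → ℕ
numZeros w = sum (map (λ x → if is0 x then 1 else 0) (toList w))

V : ℕ → Set
V m = Σ (Word m) (λ w → T (correct w))

toV : {m : ℕ} → Word m → Maybe (V m)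
toV w with T? (correct w)
... | yes c = just (w , c)
... | no _ = nothing

vertices : (m : ℕ) → List (V m)
vertices m = mapMaybe toV (allWords m)

Matrix : ℕ → Set
Matrix m = V m → V m → ℕ∞

A : (m : ℕ) → Matrix m
A m (q , _) (p , _) = if canFollow q p then just (numZeros p) else ∞

_⊠_ : {m : ℕ} → Matrix m → Matrix m → Matrix m
_⊠_ {m} M N i j = foldr (λ k acc → min∞ (M i k +∞ N k j) acc) ∞ (vertices m)

-- mpow M k = M^(k+1), the (k+1)-fold (min,+) product of M with itself
mpow : {m : ℕ} → Matrix m → ℕ → Matrix m
mpow M zero = M
mpow M (suc k) = mpow M k ⊠ M

-- M^n for n ≥ 1
_^_ : {m : ℕ} → Matrix m → ℕ → Matrix m
M ^ n = mpow M (n ∸ 1)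

minDiag : {m : ℕ} → Matrix m → ℕ∞
minDiag {m} M = foldr (λ i acc → min∞ (M i i) acc) ∞ (vertices m)

pathAdj : {k : ℕ} → Fin k → Fin k → Bool
pathAdj a b = (toℕ b ≡ᵇ suc (toℕ a)) ∨ (toℕ a ≡ᵇ suc (toℕ b))

cycAdj : {n : ℕ} → Fin n → Fin n → Bool
cycAdj {n} a b = pathAdj a b
  ∨ ((toℕ a ≡ᵇ 0) ∧ (toℕ b ≡ᵇ (n ∸ 1)))
  ∨ ((toℕ b ≡ᵇ 0) ∧ (toℕ a ≡ᵇ (n ∸ 1)))

finEq : {k : ℕ} → Fin k → Fin k → Bool
finEq a b = toℕ a ≡ᵇ toℕ b

adj : {m n : ℕ} → Fin m × Fin n → Fin m × Fin n → Bool
adj (g₁ , h₁) (g₂ , h₂) = (finEq g₁ g₂ ∧ cycAdj h₁ h₂) ∨ (pathAdj g₁ g₂ ∧ finEq h₁ h₂)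

VSubset : ℕ → ℕ → Set
VSubset m n = Fin m → Fin n → Bool

size : {m n : ℕ} → VSubset m n → ℕ
size {m} {n} S = sum (map (λ i → sum (map (λ j → if S i j then 1 else 0) (allFin n))) (allFin m))

nbrsIn : {m n : ℕ} → VSubset m n → Fin m × Fin n → ℕ
nbrsIn S u = size (λ i j → adj u (i , j) ∧ S i j)

TwoDominating : {m n : ℕ} → VSubset m n → Set
TwoDominating {m} {n} S = (i : Fin m) (j : Fin n) → S i j ≡ false → 2 ≤ nbrsIn S (i , j)

IsGamma2 : ℕ → ℕ → ℕ → Set
IsGamma2 m n k =
  Σ (VSubset m n) (λ S → TwoDominating S × size S ≡ k)
  × ((S : VSubset m n) → TwoDominating S → k ≤ size S)

-- Read a subset S of P_m □ C_n column by column and label each vertex 0 if it lies in S,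
-- 1 if at least two of its neighbours above, below and in the previous column lie in S,
-- and 2 otherwise, in which case 2-domination forces its neighbour in the next column into
-- S. For a 2-dominating set the n columns are correct m-words, each can follow the previous
-- one, and they form a closed walk of length n in D_m whose weight, the number of 0s, is |S|.
-- Conversely the 0s along a closed walk of length n in D_m form a 2-dominating set of size
-- equal to the weight. The diagonal entries of A(D_m)^n are the least weights of closed
-- walks of length n, so their minimum is γ₂(P_m □ C_n).

module Submission where

open import Defs
open import Data.Nat using (ℕ; zero; suc; _+_; _*_; _≤_; _<_; _∸_; _≡ᵇ_; _≤ᵇ_; z≤n; s≤s; _⊓_)
open import Data.Nat.Properties
open import Data.Nat.Tactic.RingSolver using (solve-∀)
open import Data.Nat.ListAction using (sum)
open import Algebra.Properties.CommutativeSemigroup +-commutativeSemigroup using (interchange)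
open import Data.Bool using (Bool; true; false; T; _∧_; _∨_; not; if_then_else_)
open import Data.Bool.Properties using (T?; T-irrelevant; ∨-identityʳ; ∧-identityʳ; ∧-zeroʳ; ∨-comm)
open import Data.Maybe using (Maybe; just; nothing)
open import Data.Maybe.Properties using (just-injective)
import Data.Maybe.Relation.Unary.Any as MaybeAny
open import Data.List using (List; []; _∷_; foldr; map; length; reverse; _++_; allFin; tabulate)
open import Data.List.Properties using (map-tabulate; unfold-reverse; length-reverse)
open import Data.List.Membership.Propositional using (_∈_)
open import Data.List.Membership.Propositional.Properties using (∈-concatMap⁺)
open import Data.List.Relation.Unary.Any using (here; there)
import Data.List.Relation.Unary.Any as Any
open import Data.List.Relation.Unary.Any.Properties using (map⁺; mapMaybe⁺)
open import Data.Vec using (toList)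
import Data.Vec as Vec
open import Data.Vec.Properties using (length-toList)
open import Data.Fin using (Fin; toℕ; fromℕ<)
import Data.Fin as Fin
open import Data.Fin.Properties using (toℕ<n; toℕ-fromℕ<)
open import Data.Product using (Σ; _×_; _,_; proj₁; proj₂; map₂)
open import Data.Sum using (_⊎_; inj₁; inj₂)
open import Data.Empty using (⊥-elim)
open import Relation.Nullary using (yes; no)
open import Relation.Binary.PropositionalEquality

≡ᵇ-refl : ∀ x → (x ≡ᵇ x) ≡ true
≡ᵇ-refl zero = refl
≡ᵇ-refl (suc x) = ≡ᵇ-refl x

≡ᵇ-sym : ∀ x y → (x ≡ᵇ y) ≡ (y ≡ᵇ x)
≡ᵇ-sym zero zero = refl
≡ᵇ-sym zero (suc y) = refl
≡ᵇ-sym (suc x) zero = refl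
≡ᵇ-sym (suc x) (suc y) = ≡ᵇ-sym x y

≡ᵇ⇒≡′ : ∀ x y → (x ≡ᵇ y) ≡ true → x ≡ y
≡ᵇ⇒≡′ x y e = ≡ᵇ⇒≡ x y (subst T (sym e) _)

≢⇒≡ᵇ-false : ∀ x y → x ≢ y → (x ≡ᵇ y) ≡ false
≢⇒≡ᵇ-false x y x≢y with x ≡ᵇ y in eq
... | true = ⊥-elim (x≢y (≡ᵇ⇒≡′ x y eq))
... | false = refl

∧-trueˡ : ∀ P {Q} → P ∧ Q ≡ true → P ≡ true
∧-trueˡ true _ = refl

∧-trueʳ : ∀ P {Q} → P ∧ Q ≡ true → Q ≡ true
∧-trueʳ true e = e

∧-true : ∀ {P Q} → P ≡ true → Q ≡ true → P ∧ Q ≡ true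
∧-true refl refl = refl

ind : Bool → ℕ
ind b = if b then 1 else 0

ind-∧ : ∀ P Q → ind (P ∧ Q) ≡ ind P * ind Q
ind-∧ true Q = sym (+-identityʳ (ind Q))
ind-∧ false Q = refl

ind-∨ : ∀ P Q → (P ≡ true → Q ≡ false) → ind (P ∨ Q) ≡ ind P + ind Q
ind-∨ true Q P⇒¬Q rewrite P⇒¬Q refl = refl
ind-∨ false Q P⇒¬Q = refl

-- Tropical minima and walks

min∞-sel : ∀ a b {k} → min∞ a b ≡ just k → a ≡ just k ⊎ b ≡ just k
min∞-sel nothing b e = inj₂ e
min∞-sel (just x) nothing e = inj₁ e
min∞-sel (just x) (just y) refl with ⊓-sel x y
... | inj₁ eq = inj₁ (cong just (sym eq))
... | inj₂ eq = inj₂ (cong just (sym eq))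

min∞-≤ˡ : ∀ z b → Σ ℕ λ k → min∞ (just z) b ≡ just k × k ≤ z
min∞-≤ˡ z nothing = z , refl , ≤-refl
min∞-≤ˡ z (just y) = z ⊓ y , refl , m⊓n≤m z y

min∞-≤ʳ : ∀ a z → Σ ℕ λ k → min∞ a (just z) ≡ just k × k ≤ z
min∞-≤ʳ nothing z = z , refl , ≤-refl
min∞-≤ʳ (just x) z = x ⊓ z , refl , m⊓n≤n x z

+∞-just : ∀ a b {x} → a +∞ b ≡ just x →
  Σ ℕ λ a′ → Σ ℕ λ b′ → a ≡ just a′ × b ≡ just b′ × x ≡ a′ + b′
+∞-just (just a) (just b) refl = a , b , refl , refl , refl

module _ {X : Set} (g : X → ℕ∞) where

  foldMin : List X → ℕ∞
  foldMin = foldr (λ i acc → min∞ (g i) acc) ∞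

  foldMin-attained : ∀ L {k} → foldMin L ≡ just k → Σ X λ i → i ∈ L × g i ≡ just k
  foldMin-attained (x ∷ L) e with min∞-sel (g x) (foldMin L) e
  ... | inj₁ gx≡k = x , here refl , gx≡k
  ... | inj₂ rest≡k with foldMin-attained L rest≡k
  ...   | i , i∈L , gi≡k = i , there i∈L , gi≡k

  foldMin-≤ : ∀ {L i z} → i ∈ L → g i ≡ just z → Σ ℕ λ k → foldMin L ≡ just k × k ≤ z
  foldMin-≤ {x ∷ L} {z = z} (here refl) gi≡z rewrite gi≡z = min∞-≤ˡ z (foldMin L)
  foldMin-≤ {x ∷ L} (there i∈L) gi≡z with foldMin-≤ i∈L gi≡z
  ... | k′ , rest≡k′ , k′≤z rewrite rest≡k′ with min∞-≤ʳ (g x) k′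
  ...   | k , eq , k≤k′ = k , eq , ≤-trans k≤k′ k′≤z

∈-allWords : ∀ m (w : Word m) → w ∈ allWords m
∈-allWords zero Vec.[] = here refl
∈-allWords (suc m) (a Vec.∷ w) =
  ∈-concatMap⁺ prepend (Any.map (λ { refl → extend a }) (∈-allWords m w))
  where
  prepend : Word m → List (Word (suc m))
  prepend w = (l0 Vec.∷ w) ∷ (l1 Vec.∷ w) ∷ (l2 Vec.∷ w) ∷ []
  extend : ∀ a → (a Vec.∷ w) ∈ prepend w
  extend l0 = here refl
  extend l1 = there (here refl)
  extend l2 = there (there (here refl))

toV-correct : ∀ {m} (w : Word m) (c : T (correct w)) → toV w ≡ just (w , c)
toV-correct w c with T? (correct w)
... | yes c′ = cong (λ c → just (w , c)) (T-irrelevant c′ c)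
... | no ¬c = ⊥-elim (¬c c)

∈-vertices : ∀ {m} (v : V m) → v ∈ vertices m
∈-vertices {m} (w , c) = mapMaybe⁺ toV (allWords m) (map⁺ (Any.map toV-w (∈-allWords m w)))
  where
  toV-w : ∀ {u} → w ≡ u → MaybeAny.Any ((w , c) ≡_) (toV u)
  toV-w refl rewrite toV-correct w c = MaybeAny.just refl

module Walks {m : ℕ} (M : Matrix m) where

  walkWeight : (ℕ → V m) → ℕ → ℕ∞
  walkWeight f zero = M (f 0) (f 1)
  walkWeight f (suc k) = walkWeight f k +∞ M (f (suc k)) (f (suc (suc k)))

  walkWeight-cong : ∀ f g k → (∀ t → t ≤ suc k → f t ≡ g t) → walkWeight f k ≡ walkWeight g k
  walkWeight-cong f g zero f≗g = cong₂ M (f≗g 0 z≤n) (f≗g 1 (s≤s z≤n))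
  walkWeight-cong f g (suc k) f≗g =
    cong₂ _+∞_ (walkWeight-cong f g k (λ t t≤ → f≗g t (m≤n⇒m≤1+n t≤)))
               (cong₂ M (f≗g (suc k) (n≤1+n (suc k))) (f≗g (suc (suc k)) ≤-refl))

  mpow-attained : ∀ k i j {x} → mpow M k i j ≡ just x →
    Σ (ℕ → V m) λ f → f 0 ≡ i × f (suc k) ≡ j × walkWeight f k ≡ just x
  mpow-attained zero i j e = (λ t → if t ≡ᵇ 0 then i else j) , refl , refl , e
  mpow-attained (suc k) i j e
    with foldMin-attained (λ l → mpow M k i l +∞ M l j) (vertices m) e
  ... | l , _ , e′ with +∞-just _ _ e′
  ... | a , b , ea , eb , refl with mpow-attained k i l ea
  ... | f , f0 , fk , wf = f′ , f0 , f′-end , weight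
    where
    f′ : ℕ → V m
    f′ t = if t ≡ᵇ suc (suc k) then j else f t
    f′-end : f′ (suc (suc k)) ≡ j
    f′-end rewrite ≡ᵇ-refl k = refl
    f≗f′ : ∀ t → t ≤ suc k → f t ≡ f′ t
    f≗f′ t t≤ rewrite ≢⇒≡ᵇ-false t (suc (suc k)) (λ eq → <-irrefl eq (s≤s t≤)) = refl
    weight : walkWeight f′ (suc k) ≡ just (a + b)
    weight rewrite sym (walkWeight-cong f f′ k f≗f′) | wf | sym (f≗f′ (suc k) ≤-refl) | fk | f′-end | eb =
      refl

  mpow-≤-walk : ∀ k f {y} → walkWeight f k ≡ just y →
    Σ ℕ λ x → mpow M k (f 0) (f (suc k)) ≡ just x × x ≤ y
  mpow-≤-walk zero f e = _ , e , ≤-refl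
  mpow-≤-walk (suc k) f e with +∞-just _ _ e
  ... | a , b , ea , eb , refl with mpow-≤-walk k f ea
  ... | x′ , ex′ , x′≤a
    with foldMin-≤ (λ l → mpow M k (f 0) l +∞ M l (f (suc (suc k))))
                   (∈-vertices (f (suc k))) (cong₂ _+∞_ ex′ eb)
  ... | x , ex , x≤ = x , ex , ≤-trans x≤ (+-monoˡ-≤ b x′≤a)

  minDiag-≤-closedWalk : ∀ k f {y} → f (suc k) ≡ f 0 → walkWeight f k ≡ just y →
    Σ ℕ λ x → minDiag (mpow M k) ≡ just x × x ≤ y
  minDiag-≤-closedWalk k f closed e with mpow-≤-walk k f e
  ... | x , ex , x≤y
    with foldMin-≤ (λ v → mpow M k v v) (∈-vertices (f 0)) (subst (λ v → mpow M k (f 0) v ≡ just x) closed ex)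
  ... | x′ , ex′ , x′≤x = x′ , ex′ , ≤-trans x′≤x x≤y

  closedWalk-minDiag : ∀ k {γ} → minDiag (mpow M k) ≡ just γ →
    Σ (ℕ → V m) λ f → f (suc k) ≡ f 0 × walkWeight f k ≡ just γ
  closedWalk-minDiag k e with foldMin-attained (λ v → mpow M k v v) (vertices m) e
  ... | v , _ , diag≡γ with mpow-attained k v v diag≡γ
  ... | f , f0≡v , fk≡v , weight = f , trans fk≡v (sym f0≡v) , weight

-- Finite sums

sum< : ℕ → (ℕ → ℕ) → ℕ
sum< zero f = 0
sum< (suc k) f = f 0 + sum< k (λ t → f (suc t))

sum<-cong : ∀ k {f g : ℕ → ℕ} → (∀ t → t < k → f t ≡ g t) → sum< k f ≡ sum< k g
sum<-cong zero f≗g = refl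
sum<-cong (suc k) f≗g = cong₂ _+_ (f≗g 0 (s≤s z≤n)) (sum<-cong k (λ t t< → f≗g (suc t) (s≤s t<)))

sum<-0 : ∀ k → sum< k (λ _ → 0) ≡ 0
sum<-0 zero = refl
sum<-0 (suc k) = sum<-0 k

sum<-+ : ∀ k (f g : ℕ → ℕ) → sum< k (λ t → f t + g t) ≡ sum< k f + sum< k g
sum<-+ zero f g = refl
sum<-+ (suc k) f g rewrite sum<-+ k (λ t → f (suc t)) (λ t → g (suc t)) =
  interchange (f 0) (g 0) (sum< k (λ t → f (suc t))) (sum< k (λ t → g (suc t)))

sum<-*ˡ : ∀ k c (f : ℕ → ℕ) → sum< k (λ t → c * f t) ≡ c * sum< k f
sum<-*ˡ zero c f = sym (*-zeroʳ c)
sum<-*ˡ (suc k) c f rewrite sum<-*ˡ k c (λ t → f (suc t)) = sym (*-distribˡ-+ c (f 0) _)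

sum<-suc : ∀ k (f : ℕ → ℕ) → sum< (suc k) f ≡ sum< k f + f k
sum<-suc zero f = +-identityʳ (f 0)
sum<-suc (suc k) f rewrite sum<-suc k (λ t → f (suc t)) = sym (+-assoc (f 0) _ _)

sum<-swap : ∀ k l (F : ℕ → ℕ → ℕ) →
  sum< k (λ x → sum< l (λ y → F x y)) ≡ sum< l (λ y → sum< k (λ x → F x y))
sum<-swap zero l F = sym (sum<-0 l)
sum<-swap (suc k) l F rewrite sum<-swap k l (λ x y → F (suc x) y) =
  sym (sum<-+ l (F 0) (λ y → sum< k (λ x → F (suc x) y)))

sum<-δ : ∀ k p (f : ℕ → ℕ) → (k ≤ p → f p ≡ 0) → sum< k (λ t → ind (t ≡ᵇ p) * f t) ≡ f p
sum<-δ zero p f out = sym (out z≤n)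
sum<-δ (suc k) zero f out = trans (cong₂ _+_ (*-identityˡ (f 0)) (sum<-0 k)) (+-identityʳ (f 0))
sum<-δ (suc k) (suc p) f out = sum<-δ k p (λ t → f (suc t)) (λ k≤p → out (s≤s k≤p))

sum<-δ₃ : ∀ l α β p q r (τ : ℕ → ℕ) → (∀ b → l ≤ b → τ b ≡ 0) →
  sum< l (λ b → (α * (ind (b ≡ᵇ p) + ind (b ≡ᵇ q)) + β * ind (b ≡ᵇ r)) * τ b)
    ≡ α * (τ p + τ q) + β * τ r
sum<-δ₃ l α β p q r τ τ-out = begin
  sum< l (λ b → (α * (δ p b + δ q b) + β * δ r b) * τ b)
    ≡⟨ sum<-cong l (λ b _ → distribute α β (δ p b) (δ q b) (δ r b) (τ b)) ⟩
  sum< l (λ b → α * (δ p b * τ b + δ q b * τ b) + β * (δ r b * τ b))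
    ≡⟨ sum<-+ l _ _ ⟩
  sum< l (λ b → α * (δ p b * τ b + δ q b * τ b)) + sum< l (λ b → β * (δ r b * τ b))
    ≡⟨ cong₂ _+_ (sum<-*ˡ l α _) (sum<-*ˡ l β _) ⟩
  α * sum< l (λ b → δ p b * τ b + δ q b * τ b) + β * sum< l (λ b → δ r b * τ b)
    ≡⟨ cong (λ z → α * z + β * sum< l (λ b → δ r b * τ b)) (sum<-+ l _ _) ⟩
  α * (sum< l (λ b → δ p b * τ b) + sum< l (λ b → δ q b * τ b)) + β * sum< l (λ b → δ r b * τ b)
    ≡⟨ cong₂ (λ u v → α * u + β * v) (cong₂ _+_ (point p) (point q)) (point r) ⟩
  α * (τ p + τ q) + β * τ r ∎
  where
  open ≡-Reasoning
  δ : ℕ → ℕ → ℕ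
  δ p b = ind (b ≡ᵇ p)
  point : ∀ p → sum< l (λ b → δ p b * τ b) ≡ τ p
  point p = sum<-δ l p τ (τ-out p)
  distribute : ∀ α β dp dq dr t → (α * (dp + dq) + β * dr) * t ≡ α * (dp * t + dq * t) + β * (dr * t)
  distribute = solve-∀

sum-tabulate : ∀ k (g : Fin k → ℕ) (f : ℕ → ℕ) → (∀ a → g a ≡ f (toℕ a)) →
  sum (tabulate g) ≡ sum< k f
sum-tabulate zero g f g≗f = refl
sum-tabulate (suc k) g f g≗f =
  cong₂ _+_ (g≗f Fin.zero) (sum-tabulate k (λ a → g (Fin.suc a)) (λ t → f (suc t)) (λ a → g≗f (Fin.suc a)))

sum-allFin : ∀ k (g : Fin k → ℕ) (f : ℕ → ℕ) → (∀ a → g a ≡ f (toℕ a)) →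
  sum (map g (allFin k)) ≡ sum< k f
sum-allFin k g f g≗f rewrite map-tabulate {n = k} (λ a → a) g = sum-tabulate k g f g≗f

liftFin : (k : ℕ) → (Fin k → Bool) → ℕ → Bool
liftFin zero P x = false
liftFin (suc k) P zero = P Fin.zero
liftFin (suc k) P (suc x) = liftFin k (λ a → P (Fin.suc a)) x

liftFin-toℕ : ∀ k P (a : Fin k) → liftFin k P (toℕ a) ≡ P a
liftFin-toℕ (suc k) P Fin.zero = refl
liftFin-toℕ (suc k) P (Fin.suc a) = liftFin-toℕ k (λ a → P (Fin.suc a)) a

liftFin-≥ : ∀ k P x → k ≤ x → liftFin k P x ≡ false
liftFin-≥ zero P x k≤x = refl
liftFin-≥ (suc k) P (suc x) (s≤s k≤x) = liftFin-≥ k _ x k≤x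

liftFin-false : ∀ k P x → (∀ a → P a ≡ false) → liftFin k P x ≡ false
liftFin-false zero P x P≗false = refl
liftFin-false (suc k) P zero P≗false = P≗false Fin.zero
liftFin-false (suc k) P (suc x) P≗false = liftFin-false k _ x (λ a → P≗false (Fin.suc a))

liftFin-cong : ∀ k {P Q} x → (∀ a → P a ≡ Q a) → liftFin k P x ≡ liftFin k Q x
liftFin-cong zero x P≗Q = refl
liftFin-cong (suc k) zero P≗Q = P≗Q Fin.zero
liftFin-cong (suc k) (suc x) P≗Q = liftFin-cong k x (λ a → P≗Q (Fin.suc a))

liftFin-∘toℕ : ∀ k (G : ℕ → Bool) x → x < k → liftFin k (λ a → G (toℕ a)) x ≡ G x
liftFin-∘toℕ (suc k) G zero x<k = refl
liftFin-∘toℕ (suc k) G (suc x) (s≤s x<k) = liftFin-∘toℕ k (λ t → G (suc t)) x x<k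

module _ {m n : ℕ} where

  memℕ : VSubset m n → ℕ → ℕ → Bool
  memℕ S x y = liftFin m (λ a → liftFin n (S a) y) x

  memℕ-toℕ : ∀ S a b → memℕ S (toℕ a) (toℕ b) ≡ S a b
  memℕ-toℕ S a b rewrite liftFin-toℕ m (λ a → liftFin n (S a) (toℕ b)) a = liftFin-toℕ n (S a) b

  memℕ-row-≥ : ∀ S x y → m ≤ x → memℕ S x y ≡ false
  memℕ-row-≥ S x y m≤x = liftFin-≥ m _ x m≤x

  memℕ-col-≥ : ∀ S x y → n ≤ y → memℕ S x y ≡ false
  memℕ-col-≥ S x y n≤y = liftFin-false m _ x (λ a → liftFin-≥ n (S a) y n≤y)

  memℕ-∘toℕ : ∀ (G : ℕ → ℕ → Bool) x y → x < m → y < n →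
    memℕ (λ a b → G (toℕ a) (toℕ b)) x y ≡ G x y
  memℕ-∘toℕ G x y x<m y<n =
    trans (liftFin-cong m x (λ a → liftFin-∘toℕ n (G (toℕ a)) y y<n))
          (liftFin-∘toℕ m (λ x → G x y) x x<m)

  size≡sum< : ∀ (S : VSubset m n) (G : ℕ → ℕ → Bool) → (∀ a b → S a b ≡ G (toℕ a) (toℕ b)) →
    size S ≡ sum< m (λ x → sum< n (λ y → ind (G x y)))
  size≡sum< S G S≗G = sum-allFin m _ _ (λ a → sum-allFin n _ _ (λ b → cong ind (S≗G a b)))

-- Neighbours in P_m □ C_n

-- ℕ-coordinate versions of pathAdj, cycAdj and adj: adj (i , j) (a , b) is
-- definitionally adjN n (toℕ i) (toℕ j) (toℕ a) (toℕ b).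
pathN : ℕ → ℕ → Bool
pathN x a = (a ≡ᵇ suc x) ∨ (x ≡ᵇ suc a)

cycN : ℕ → ℕ → ℕ → Bool
cycN n y b = pathN y b ∨ ((y ≡ᵇ 0) ∧ (b ≡ᵇ (n ∸ 1))) ∨ ((b ≡ᵇ 0) ∧ (y ≡ᵇ (n ∸ 1)))

adjN : ℕ → ℕ → ℕ → ℕ → ℕ → Bool
adjN n x y a b = ((x ≡ᵇ a) ∧ cycN n y b) ∨ (pathN x a ∧ (y ≡ᵇ b))

rowAbove : ℕ → ℕ → Bool
rowAbove zero a = false
rowAbove (suc x) a = a ≡ᵇ x

pathN-irrefl : ∀ x → pathN x x ≡ false
pathN-irrefl x rewrite ≢⇒≡ᵇ-false x (suc x) (λ ()) = refl

ind-pathN : ∀ x a → ind (pathN x a) ≡ ind (rowAbove x a) + ind (a ≡ᵇ suc x)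
ind-pathN zero a rewrite ∨-identityʳ (a ≡ᵇ 1) = refl
ind-pathN (suc x) a = begin
  ind (pathN (suc x) a)
    ≡⟨ ind-∨ (a ≡ᵇ suc (suc x)) (x ≡ᵇ a) disjoint ⟩
  ind (a ≡ᵇ suc (suc x)) + ind (x ≡ᵇ a)
    ≡⟨ +-comm _ (ind (x ≡ᵇ a)) ⟩
  ind (x ≡ᵇ a) + ind (a ≡ᵇ suc (suc x))
    ≡⟨ cong (λ P → ind P + ind (a ≡ᵇ suc (suc x))) (≡ᵇ-sym x a) ⟩
  ind (a ≡ᵇ x) + ind (a ≡ᵇ suc (suc x)) ∎
  where
  open ≡-Reasoning
  disjoint : (a ≡ᵇ suc (suc x)) ≡ true → (x ≡ᵇ a) ≡ false
  disjoint e rewrite ≡ᵇ⇒≡′ a _ e = ≢⇒≡ᵇ-false x (suc (suc x)) (λ ())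

before : (ℕ → ℕ) → ℕ → ℕ
before f zero = 0
before f (suc x) = f x

sum<-rowAbove : ∀ k x (f : ℕ → ℕ) → (∀ a → k ≤ a → f a ≡ 0) →
  sum< k (λ a → ind (rowAbove x a) * f a) ≡ before f x
sum<-rowAbove k zero f f-out = sum<-0 k
sum<-rowAbove k (suc x) f f-out = sum<-δ k x f (f-out x)

module Cycle (k : ℕ) where

  n : ℕ
  n = 3 + k

  cycPred cycSuc : ℕ → ℕ
  cycPred zero = suc (suc k)
  cycPred (suc y) = y
  cycSuc y = if suc y ≡ᵇ n then 0 else suc y

  cycSuc-last : cycSuc (suc (suc k)) ≡ 0
  cycSuc-last rewrite ≡ᵇ-refl k = refl

  cycSuc-inner : ∀ y → suc y < n → cycSuc y ≡ suc y
  cycSuc-inner y sy<n rewrite ≢⇒≡ᵇ-false (suc y) n (<⇒≢ sy<n) = refl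

  cycPred-< : ∀ y → y < n → cycPred y < n
  cycPred-< zero _ = n<1+n (suc (suc k))
  cycPred-< (suc y) y<n = m<n⇒m<1+n (≤-pred y<n)

  cycSuc-cycPred : ∀ y → y < n → cycSuc (cycPred y) ≡ y
  cycSuc-cycPred zero _ = cycSuc-last
  cycSuc-cycPred (suc y) y<n = cycSuc-inner y y<n

  cycSuc-< : ∀ y → y < n → cycSuc y < n
  cycSuc-< y y<n with y ≟ suc (suc k)
  ... | yes refl rewrite cycSuc-last = s≤s z≤n
  ... | no y≢2+k rewrite cycSuc-inner y (s≤s (≤∧≢⇒< (≤-pred y<n) y≢2+k)) =
    s≤s (≤∧≢⇒< (≤-pred y<n) y≢2+k)

  cycPred-cycSuc : ∀ y → y < n → cycPred (cycSuc y) ≡ y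
  cycPred-cycSuc y y<n with y ≟ suc (suc k)
  ... | yes refl rewrite cycSuc-last = refl
  ... | no y≢2+k rewrite cycSuc-inner y (s≤s (≤∧≢⇒< (≤-pred y<n) y≢2+k)) = refl

  cycPred≢cycSuc : ∀ y → y < n → cycPred y ≢ cycSuc y
  cycPred≢cycSuc zero _ ()
  cycPred≢cycSuc (suc y) y<n with y ≟ suc k
  ... | yes refl rewrite cycSuc-last = λ ()
  ... | no y≢1+k rewrite cycSuc-inner (suc y) (s≤s (s≤s (≤∧≢⇒< (≤-pred (≤-pred y<n)) y≢1+k))) = λ ()

  cycN-pred∨suc : ∀ y b → b < n → cycN n y b ≡ (b ≡ᵇ cycPred y) ∨ (b ≡ᵇ cycSuc y)
  cycN-pred∨suc zero b _
    rewrite ∨-identityʳ (b ≡ᵇ 1) | ∧-zeroʳ (b ≡ᵇ 0) | ∨-identityʳ (b ≡ᵇ suc (suc k)) =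
    ∨-comm (b ≡ᵇ 1) (b ≡ᵇ suc (suc k))
  cycN-pred∨suc (suc y) b b<n with y ≟ suc k
  ... | yes refl rewrite cycSuc-last | ≡ᵇ-refl k | ≢⇒≡ᵇ-false b n (<⇒≢ b<n) | ∧-identityʳ (b ≡ᵇ 0) =
    cong (_∨ (b ≡ᵇ 0)) (≡ᵇ-sym (suc k) b)
  ... | no y≢1+k
    rewrite ≢⇒≡ᵇ-false y (suc k) y≢1+k | ∧-zeroʳ (b ≡ᵇ 0) | ∨-identityʳ ((b ≡ᵇ suc (suc y)) ∨ (y ≡ᵇ b)) =
    trans (cong ((b ≡ᵇ suc (suc y)) ∨_) (≡ᵇ-sym y b)) (∨-comm (b ≡ᵇ suc (suc y)) (b ≡ᵇ y))

  ind-cycN : ∀ y b → y < n → b < n → ind (cycN n y b) ≡ ind (b ≡ᵇ cycPred y) + ind (b ≡ᵇ cycSuc y)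
  ind-cycN y b y<n b<n rewrite cycN-pred∨suc y b b<n = ind-∨ _ _ disjoint
    where
    disjoint : (b ≡ᵇ cycPred y) ≡ true → (b ≡ᵇ cycSuc y) ≡ false
    disjoint e rewrite ≡ᵇ⇒≡′ b _ e = ≢⇒≡ᵇ-false _ _ (cycPred≢cycSuc y y<n)

  ind-adjN : ∀ x y a b → y < n → b < n →
    ind (adjN n x y a b) ≡ ind (a ≡ᵇ x) * (ind (b ≡ᵇ cycPred y) + ind (b ≡ᵇ cycSuc y))
                         + (ind (rowAbove x a) + ind (a ≡ᵇ suc x)) * ind (b ≡ᵇ y)
  ind-adjN x y a b y<n b<n = begin
    ind (adjN n x y a b)
      ≡⟨ ind-∨ ((x ≡ᵇ a) ∧ cycN n y b) _ disjoint ⟩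
    ind ((x ≡ᵇ a) ∧ cycN n y b) + ind (pathN x a ∧ (y ≡ᵇ b))
      ≡⟨ cong₂ _+_ (ind-∧ (x ≡ᵇ a) _) (ind-∧ (pathN x a) _) ⟩
    ind (x ≡ᵇ a) * ind (cycN n y b) + ind (pathN x a) * ind (y ≡ᵇ b)
      ≡⟨ cong₂ _+_ (cong₂ _*_ (cong ind (≡ᵇ-sym x a)) (ind-cycN y b y<n b<n))
                   (cong₂ _*_ (ind-pathN x a) (cong ind (≡ᵇ-sym y b))) ⟩
    ind (a ≡ᵇ x) * (ind (b ≡ᵇ cycPred y) + ind (b ≡ᵇ cycSuc y))
      + (ind (rowAbove x a) + ind (a ≡ᵇ suc x)) * ind (b ≡ᵇ y) ∎
    where
    open ≡-Reasoning
    disjoint : ((x ≡ᵇ a) ∧ cycN n y b) ≡ true → (pathN x a ∧ (y ≡ᵇ b)) ≡ false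
    disjoint e with ≡ᵇ⇒≡′ x a (∧-trueˡ (x ≡ᵇ a) e)
    ... | refl rewrite pathN-irrefl x = refl

module NeighbourCount {k m : ℕ} (S : VSubset m (3 + k)) where

  open Cycle k

  s : ℕ → ℕ → Bool
  s = memℕ S

  σ : ℕ → ℕ → ℕ
  σ a b = ind (s a b)

  σ-row : ∀ a b → m ≤ a → σ a b ≡ 0
  σ-row a b m≤a = cong ind (memℕ-row-≥ S a b m≤a)

  nbrsExceptNext : ℕ → ℕ → ℕ
  nbrsExceptNext x y = (before (λ a → σ a y) x + σ (suc x) y) + σ x (cycPred y)

  ind-adjN∧s : ∀ x y a b → y < n →
    ind (adjN n x y a b ∧ s a b)
      ≡ (ind (a ≡ᵇ x) * (ind (b ≡ᵇ cycPred y) + ind (b ≡ᵇ cycSuc y))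
         + (ind (rowAbove x a) + ind (a ≡ᵇ suc x)) * ind (b ≡ᵇ y)) * σ a b
  ind-adjN∧s x y a b y<n with b <? n
  ... | yes b<n = trans (ind-∧ (adjN n x y a b) (s a b)) (cong (_* σ a b) (ind-adjN x y a b y<n b<n))
  ... | no b≮n rewrite memℕ-col-≥ S a b (≮⇒≥ b≮n) | ∧-zeroʳ (adjN n x y a b) =
    sym (*-zeroʳ (ind (a ≡ᵇ x) * (ind (b ≡ᵇ cycPred y) + ind (b ≡ᵇ cycSuc y))
                  + (ind (rowAbove x a) + ind (a ≡ᵇ suc x)) * ind (b ≡ᵇ y)))

  sum<-verticalNbrs : ∀ x y →
    sum< m (λ a → (ind (rowAbove x a) + ind (a ≡ᵇ suc x)) * σ a y) ≡ before (λ a → σ a y) x + σ (suc x) y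
  sum<-verticalNbrs x y = begin
    sum< m (λ a → (ind (rowAbove x a) + ind (a ≡ᵇ suc x)) * σ a y)
      ≡⟨ sum<-cong m (λ a _ → *-distribʳ-+ (σ a y) (ind (rowAbove x a)) (ind (a ≡ᵇ suc x))) ⟩
    sum< m (λ a → ind (rowAbove x a) * σ a y + ind (a ≡ᵇ suc x) * σ a y)
      ≡⟨ sum<-+ m _ _ ⟩
    sum< m (λ a → ind (rowAbove x a) * σ a y) + sum< m (λ a → ind (a ≡ᵇ suc x) * σ a y)
      ≡⟨ cong₂ _+_ (sum<-rowAbove m x (λ a → σ a y) (λ a → σ-row a y))
                   (sum<-δ m (suc x) (λ a → σ a y) (σ-row (suc x) y)) ⟩
    before (λ a → σ a y) x + σ (suc x) y ∎
    where open ≡-Reasoning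

  nbrsIn≡ : ∀ i j → let x = toℕ i; y = toℕ j in
    nbrsIn S (i , j) ≡ nbrsExceptNext x y + σ x (cycSuc y)
  nbrsIn≡ i j = begin
    nbrsIn S (i , j)
      ≡⟨ size≡sum< _ (λ a b → adjN n x y a b ∧ s a b)
                     (λ a b → cong (adj (i , j) (a , b) ∧_) (sym (memℕ-toℕ S a b))) ⟩
    sum< m (λ a → sum< n (λ b → ind (adjN n x y a b ∧ s a b)))
      ≡⟨ sum<-cong m (λ a _ → trans (sum<-cong n (λ b _ → ind-adjN∧s x y a b y<n))
                                   (sum<-δ₃ n (δ x a) (ρ a) (cycPred y) (cycSuc y) y (σ a) (col-out a))) ⟩
    sum< m (λ a → δ x a * (σ a (cycPred y) + σ a (cycSuc y)) + ρ a * σ a y)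
      ≡⟨ sum<-+ m _ _ ⟩
    sum< m (λ a → δ x a * (σ a (cycPred y) + σ a (cycSuc y))) + sum< m (λ a → ρ a * σ a y)
      ≡⟨ cong₂ _+_ (sum<-δ m x (λ a → σ a (cycPred y) + σ a (cycSuc y))
                      (λ m≤x → cong₂ _+_ (σ-row x (cycPred y) m≤x) (σ-row x (cycSuc y) m≤x)))
                   (sum<-verticalNbrs x y) ⟩
    (σ x (cycPred y) + σ x (cycSuc y)) + (before (λ a → σ a y) x + σ (suc x) y)
      ≡⟨ rearrange (σ x (cycPred y)) (σ x (cycSuc y)) (before (λ a → σ a y) x) (σ (suc x) y) ⟩
    nbrsExceptNext x y + σ x (cycSuc y) ∎
    where
    open ≡-Reasoning
    x y : ℕ
    x = toℕ i
    y = toℕ j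
    y<n : y < n
    y<n = toℕ<n j
    δ : ℕ → ℕ → ℕ
    δ p a = ind (a ≡ᵇ p)
    ρ : ℕ → ℕ
    ρ a = ind (rowAbove x a) + δ (suc x) a
    col-out : ∀ a b → n ≤ b → σ a b ≡ 0
    col-out a b n≤b = cong ind (memℕ-col-≥ S a b n≤b)
    rearrange : ∀ l r u d → (l + r) + (u + d) ≡ ((u + d) + l) + r
    rearrange = solve-∀

-- Correct words and the follow relation

_⇒ᵇ_ : Bool → Bool → Bool
P ⇒ᵇ Q = not P ∨ Q

⇒ᵇ-elim : ∀ P {Q} → (P ⇒ᵇ Q) ≡ true → P ≡ true → Q ≡ true
⇒ᵇ-elim true e refl = e

∀ᴸ : (Letter → Bool) → Bool
∀ᴸ P = P l0 ∧ P l1 ∧ P l2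

∀ᴸ-elim : ∀ (P : Letter → Bool) → ∀ᴸ P ≡ true → ∀ a → P a ≡ true
∀ᴸ-elim P h l0 = ∧-trueˡ (P l0) h
∀ᴸ-elim P h l1 = ∧-trueˡ (P l1) (∧-trueʳ (P l0) h)
∀ᴸ-elim P h l2 = ∧-trueʳ (P l1) (∧-trueʳ (P l0) h)

∀ᴸ₂-elim : ∀ (P : Letter → Letter → Bool) →
  ∀ᴸ (λ a → ∀ᴸ (P a)) ≡ true → ∀ a b → P a b ≡ true
∀ᴸ₂-elim P h a = ∀ᴸ-elim (P a) (∀ᴸ-elim (λ a → ∀ᴸ (P a)) h a)

∀ᴸ₃-elim : ∀ (P : Letter → Letter → Letter → Bool) →
  ∀ᴸ (λ a → ∀ᴸ (λ b → ∀ᴸ (P a b))) ≡ true → ∀ a b c → P a b c ≡ true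
∀ᴸ₃-elim P h a = ∀ᴸ₂-elim (P a) (∀ᴸ-elim (λ a → ∀ᴸ (λ b → ∀ᴸ (P a b))) h a)

∀ᴸ₄-elim : ∀ (P : Letter → Letter → Letter → Letter → Bool) →
  ∀ᴸ (λ a → ∀ᴸ (λ b → ∀ᴸ (λ c → ∀ᴸ (P a b c)))) ≡ true → ∀ a b c d → P a b c d ≡ true
∀ᴸ₄-elim P h a = ∀ᴸ₃-elim (P a) (∀ᴸ-elim (λ a → ∀ᴸ (λ b → ∀ᴸ (λ c → ∀ᴸ (P a b c)))) h a)

-- The next three facts are checked by evaluation on all combinations of letters.
badBlock-local : ∀ a b c q → localOK (just a) (just c) q b ≡ true → not (badBlock a b c) ≡ true
badBlock-local a b c q =
  ⇒ᵇ-elim (localOK (just a) (just c) q b)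
    (∀ᴸ₄-elim (λ a b c q → localOK (just a) (just c) q b ⇒ᵇ not (badBlock a b c)) refl a b c q)

startOK-local : ∀ a b q → localOK nothing (just b) q a ≡ true → startOK (a ∷ b ∷ []) ≡ true
startOK-local a b q =
  ⇒ᵇ-elim (localOK nothing (just b) q a)
    (∀ᴸ₃-elim (λ a b q → localOK nothing (just b) q a ⇒ᵇ startOK (a ∷ b ∷ [])) refl a b q)

endOK-local : ∀ a b q → localOK (just a) nothing q b ≡ true → startOK (b ∷ a ∷ []) ≡ true
endOK-local a b q =
  ⇒ᵇ-elim (localOK (just a) nothing q b)
    (∀ᴸ₃-elim (λ a b q → localOK (just a) nothing q b ⇒ᵇ startOK (b ∷ a ∷ [])) refl a b q)

noBadBlock-follows : ∀ p qs ps → length qs ≡ length ps → followsL p qs ps ≡ true → noBadBlock ps ≡ true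
noBadBlock-follows p qs [] _ _ = refl
noBadBlock-follows p qs (a ∷ []) _ _ = refl
noBadBlock-follows p qs (a ∷ b ∷ []) _ _ = refl
noBadBlock-follows p (qa ∷ qb ∷ qc ∷ qs) (a ∷ b ∷ c ∷ ps) len e =
  ∧-true (badBlock-local a b c qb (∧-trueˡ (localOK (just a) (just c) qb b) rest))
         (noBadBlock-follows (just a) (qb ∷ qc ∷ qs) (b ∷ c ∷ ps) (suc-injective len) rest)
  where
  rest : followsL (just a) (qb ∷ qc ∷ qs) (b ∷ c ∷ ps) ≡ true
  rest = ∧-trueʳ (localOK p (just b) qa a) e

startOK-follows : ∀ qs ps → length qs ≡ length ps → followsL nothing qs ps ≡ true → startOK ps ≡ true
startOK-follows qs [] _ _ = refl
startOK-follows qs (a ∷ []) _ _ = refl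
startOK-follows (qa ∷ qs) (a ∷ b ∷ ps) _ e = startOK-local a b qa (∧-trueˡ (localOK nothing (just b) qa a) e)

lastOK : List Letter → Bool
lastOK (a ∷ b ∷ []) = startOK (b ∷ a ∷ [])
lastOK (a ∷ b ∷ c ∷ ps) = lastOK (b ∷ c ∷ ps)
lastOK _ = true

lastOK-follows : ∀ p qs ps → length qs ≡ length ps → followsL p qs ps ≡ true → lastOK ps ≡ true
lastOK-follows p qs [] _ _ = refl
lastOK-follows p qs (a ∷ []) _ _ = refl
lastOK-follows p (qa ∷ qb ∷ []) (a ∷ b ∷ []) _ e =
  endOK-local a b qb (∧-trueˡ (localOK (just a) nothing qb b) (∧-trueʳ (localOK p (just b) qa a) e))
lastOK-follows p (qa ∷ qb ∷ qc ∷ qs) (a ∷ b ∷ c ∷ ps) len e =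
  lastOK-follows (just a) (qb ∷ qc ∷ qs) (b ∷ c ∷ ps) (suc-injective len) (∧-trueʳ (localOK p (just b) qa a) e)

startOK-reverse : ∀ ps → startOK (reverse ps) ≡ lastOK ps
startOK-reverse [] = refl
startOK-reverse (a ∷ []) = refl
startOK-reverse (a ∷ b ∷ []) = refl
startOK-reverse (a ∷ b ∷ c ∷ ps) = begin
  startOK (reverse (a ∷ b ∷ c ∷ ps))              ≡⟨ cong startOK (unfold-reverse a (b ∷ c ∷ ps)) ⟩
  startOK (reverse (b ∷ c ∷ ps) ++ a ∷ [])        ≡⟨ startOK-++ (reverse (b ∷ c ∷ ps)) 2≤len ⟩
  startOK (reverse (b ∷ c ∷ ps))                  ≡⟨ startOK-reverse (b ∷ c ∷ ps) ⟩
  lastOK (b ∷ c ∷ ps)                              ∎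
  where
  open ≡-Reasoning
  startOK-++ : ∀ ls → 2 ≤ length ls → startOK (ls ++ a ∷ []) ≡ startOK ls
  startOK-++ (x ∷ y ∷ ls) _ = refl
  startOK-++ (x ∷ []) (s≤s ())
  2≤len : 2 ≤ length (reverse (b ∷ c ∷ ps))
  2≤len rewrite length-reverse (b ∷ c ∷ ps) = s≤s (s≤s z≤n)

correct-canFollow : ∀ {m} (q p : Word m) → canFollow q p ≡ true → correct p ≡ true
correct-canFollow q p e =
  ∧-true (noBadBlock-follows nothing (toList q) (toList p) len e)
    (∧-true (startOK-follows (toList q) (toList p) len e)
            (trans (startOK-reverse (toList p)) (lastOK-follows nothing (toList q) (toList p) len e)))
  where
  len : length (toList q) ≡ length (toList p)
  len = trans (length-toList q) (sym (length-toList p))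

tabulateℕ : (k : ℕ) → (ℕ → Letter) → Word k
tabulateℕ zero F = Vec.[]
tabulateℕ (suc k) F = F 0 Vec.∷ tabulateℕ k (λ t → F (suc t))

lookupℕ : ∀ {m} → Word m → ℕ → Letter
lookupℕ Vec.[] x = l1   -- junk: only positions below the length are ever looked up
lookupℕ (a Vec.∷ w) zero = a
lookupℕ (a Vec.∷ w) (suc x) = lookupℕ w x

tabulateℕ-lookupℕ : ∀ {m} (w : Word m) → tabulateℕ m (lookupℕ w) ≡ w
tabulateℕ-lookupℕ Vec.[] = refl
tabulateℕ-lookupℕ (a Vec.∷ w) = cong (a Vec.∷_) (tabulateℕ-lookupℕ w)

numZeros-tabulateℕ : ∀ k F → numZeros (tabulateℕ k F) ≡ sum< k (λ t → ind (is0 (F t)))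
numZeros-tabulateℕ zero F = refl
numZeros-tabulateℕ (suc k) F = cong (ind (is0 (F 0)) +_) (numZeros-tabulateℕ k (λ t → F (suc t)))

prevLetter : Maybe Letter → (ℕ → Letter) → ℕ → Maybe Letter
prevLetter p P zero = p
prevLetter p P (suc x) = just (P x)

nextLetter : ℕ → (ℕ → Letter) → ℕ → Maybe Letter
nextLetter zero P x = nothing
nextLetter (suc zero) P x = nothing
nextLetter (suc (suc k)) P zero = just (P 1)
nextLetter (suc (suc k)) P (suc x) = nextLetter (suc k) (λ t → P (suc t)) x

nextLetter-inner : ∀ k P x → suc x < k → nextLetter k P x ≡ just (P (suc x))
nextLetter-inner (suc zero) P zero (s≤s ())
nextLetter-inner (suc (suc k)) P zero _ = refl
nextLetter-inner (suc (suc k)) P (suc x) (s≤s sx<k) = nextLetter-inner (suc k) (λ t → P (suc t)) x sx<k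

nextLetter-last : ∀ k P x → suc x ≡ k → nextLetter k P x ≡ nothing
nextLetter-last (suc zero) P zero _ = refl
nextLetter-last (suc (suc k)) P (suc x) e = nextLetter-last (suc k) (λ t → P (suc t)) x (suc-injective e)

localAt : ℕ → Maybe Letter → (ℕ → Letter) → (ℕ → Letter) → ℕ → Bool
localAt k p Q P x = localOK (prevLetter p P x) (nextLetter k P x) (Q x) (P x)

localAt-suc : ∀ k p Q P x →
  localAt (suc k) p Q P (suc x) ≡ localAt k (just (P 0)) (λ t → Q (suc t)) (λ t → P (suc t)) x
localAt-suc zero p Q P zero = refl
localAt-suc zero p Q P (suc x) = refl
localAt-suc (suc k) p Q P zero = refl
localAt-suc (suc k) p Q P (suc x) = refl

localAt-zero : ∀ k p Q P →
  localOK p (headM (toList (tabulateℕ k (λ t → P (suc t))))) (Q 0) (P 0) ≡ localAt (suc k) p Q P 0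
localAt-zero zero p Q P = refl
localAt-zero (suc k) p Q P = refl

followsL⇒localAt : ∀ k p Q P → followsL p (toList (tabulateℕ k Q)) (toList (tabulateℕ k P)) ≡ true →
  ∀ x → x < k → localAt k p Q P x ≡ true
followsL⇒localAt (suc k) p Q P e zero _ =
  trans (sym (localAt-zero k p Q P)) (∧-trueˡ (localOK p _ (Q 0) (P 0)) e)
followsL⇒localAt (suc k) p Q P e (suc x) (s≤s x<k) =
  trans (localAt-suc k p Q P x)
        (followsL⇒localAt k (just (P 0)) _ _ (∧-trueʳ (localOK p _ (Q 0) (P 0)) e) x x<k)

localAt⇒followsL : ∀ k p Q P → (∀ x → x < k → localAt k p Q P x ≡ true) →
  followsL p (toList (tabulateℕ k Q)) (toList (tabulateℕ k P)) ≡ true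
localAt⇒followsL zero p Q P _ = refl
localAt⇒followsL (suc k) p Q P h =
  ∧-true (trans (localAt-zero k p Q P) (h 0 (s≤s z≤n)))
         (localAt⇒followsL k (just (P 0)) _ _ (λ x x<k → trans (sym (localAt-suc k p Q P x)) (h (suc x) (s≤s x<k))))

canFollow⇒localAt : ∀ {m} (q p : Word m) → canFollow q p ≡ true →
  ∀ x → x < m → localAt m nothing (lookupℕ q) (lookupℕ p) x ≡ true
canFollow⇒localAt {m} q p e =
  followsL⇒localAt m nothing (lookupℕ q) (lookupℕ p)
    (subst₂ (λ q p → canFollow q p ≡ true) (sym (tabulateℕ-lookupℕ q)) (sym (tabulateℕ-lookupℕ p)) e)

-- Labels of the vertices

-- localOK prev next q p is definitionally
-- localCond (zeroCount prev + zeroCount next + zeroCount (just q)) q p.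
localCond : ℕ → Letter → Letter → Bool
localCond z q p = (not (is2 q) ∨ is0 p) ∧ (not (is2 p) ∨ (z ≡ᵇ 1)) ∧ (not (is1 p) ∨ (2 ≤ᵇ z))

zeroCount≡ind-is0 : ∀ l → zeroCount (just l) ≡ ind (is0 l)
zeroCount≡ind-is0 l0 = refl
zeroCount≡ind-is0 l1 = refl
zeroCount≡ind-is0 l2 = refl

localCond-2⇒0 : ∀ z p → localCond z l2 p ≡ true → p ≡ l0
localCond-2⇒0 z l0 _ = refl

localCond-dominated : ∀ z q p r → is0 p ≡ false → localCond z q p ≡ true →
  (p ≡ l2 → 1 ≤ r) → 2 ≤ z + r
localCond-dominated z q l1 r _ ok _ =
  ≤-trans (≤ᵇ⇒≤ 2 z (subst T (sym (∧-trueʳ (not (is2 q) ∨ false) ok)) _)) (m≤m+n z r)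
localCond-dominated z q l2 r _ ok 1≤r
  with ≡ᵇ⇒≡′ z 1 (∧-trueˡ (z ≡ᵇ 1) (∧-trueʳ (not (is2 q) ∨ false) ok))
... | refl = s≤s (1≤r refl)

vertexLetter : Bool → ℕ → Letter
vertexLetter true c = l0
vertexLetter false c = if 2 ≤ᵇ c then l1 else l2

is0-vertexLetter : ∀ b c → is0 (vertexLetter b c) ≡ b
is0-vertexLetter true c = refl
is0-vertexLetter false c with 2 ≤ᵇ c
... | true = refl
... | false = refl

zeroCount-vertexLetter : ∀ b c → zeroCount (just (vertexLetter b c)) ≡ ind b
zeroCount-vertexLetter b c = trans (zeroCount≡ind-is0 (vertexLetter b c)) (cong ind (is0-vertexLetter b c))

≤ᵇ-false⇒≤1 : ∀ c → (2 ≤ᵇ c) ≡ false → c ≤ 1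
≤ᵇ-false⇒≤1 zero _ = z≤n
≤ᵇ-false⇒≤1 (suc zero) _ = ≤-refl

localCond-prev : ∀ b c bq cq → (bq ≡ false → 2 ≤ cq + ind b) →
  (not (is2 (vertexLetter bq cq)) ∨ is0 (vertexLetter b c)) ≡ true
localCond-prev b c true cq _ = refl
localCond-prev b c false cq domq with 2 ≤ᵇ cq in cq≱2
... | true = refl
... | false with b | domq refl
...   | true | _ = refl
...   | false | 2≤cq+0 = ⊥-elim (<⇒≱ (s≤s (≤ᵇ-false⇒≤1 cq cq≱2)) (subst (2 ≤_) (+-identityʳ cq) 2≤cq+0))

localCond-here : ∀ b c r → (b ≡ false → 2 ≤ c + ind r) →
  ((not (is2 (vertexLetter b c)) ∨ (c ≡ᵇ 1)) ∧ (not (is1 (vertexLetter b c)) ∨ (2 ≤ᵇ c))) ≡ true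
localCond-here true c r _ = refl
localCond-here false c r dom with 2 ≤ᵇ c in c≱2
... | true = refl
... | false with ≤ᵇ-false⇒≤1 c c≱2 | r | dom refl
...   | z≤n | true | s≤s ()
...   | z≤n | false | ()
...   | s≤s z≤n | _ | _ = refl

localCond-vertexLetter : ∀ b c r bq cq → (b ≡ false → 2 ≤ c + ind r) → (bq ≡ false → 2 ≤ cq + ind b) →
  localCond c (vertexLetter bq cq) (vertexLetter b c) ≡ true
localCond-vertexLetter b c r bq cq dom domq = ∧-true (localCond-prev b c bq cq domq) (localCond-here b c r dom)

module _ (m : ℕ) (P : ℕ → Letter) (τ : ℕ → ℕ)
         (P≈τ : ∀ x → x < m → zeroCount (just (P x)) ≡ τ x) (τ-out : ∀ x → m ≤ x → τ x ≡ 0) where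

  zeroCount-prevLetter : ∀ x → x < m → zeroCount (prevLetter nothing P x) ≡ before τ x
  zeroCount-prevLetter zero _ = refl
  zeroCount-prevLetter (suc x) x<m = P≈τ x (<⇒≤ x<m)

  zeroCount-nextLetter : ∀ x → x < m → zeroCount (nextLetter m P x) ≡ τ (suc x)
  zeroCount-nextLetter x x<m with suc x <? m
  ... | yes sx<m rewrite nextLetter-inner m P x sx<m = P≈τ (suc x) sx<m
  ... | no sx≮m rewrite nextLetter-last m P x (≤-antisym x<m (≮⇒≥ sx≮m)) =
    sym (τ-out (suc x) (≮⇒≥ sx≮m))

  localAt≡localCond : ∀ Q x → x < m →
    localAt m nothing Q P x ≡ localCond (before τ x + τ (suc x) + zeroCount (just (Q x))) (Q x) (P x)
  localAt≡localCond Q x x<m =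
    cong (λ z → localCond (z + zeroCount (just (Q x))) (Q x) (P x))
         (cong₂ _+_ (zeroCount-prevLetter x x<m) (zeroCount-nextLetter x x<m))

module _ {m : ℕ} where

  IsWalk : (ℕ → V m) → ℕ → Set
  IsWalk f k = ∀ t → t ≤ k → canFollow (proj₁ (f t)) (proj₁ (f (suc t))) ≡ true

  A-arc : ∀ (v w : V m) → canFollow (proj₁ v) (proj₁ w) ≡ true → A m v w ≡ just (numZeros (proj₁ w))
  A-arc (q , _) (p , _) e rewrite e = refl

  A-just : ∀ (v w : V m) {x} → A m v w ≡ just x →
    canFollow (proj₁ v) (proj₁ w) ≡ true × x ≡ numZeros (proj₁ w)
  A-just (q , _) (p , _) e with canFollow q p | e
  ... | true | refl = refl , refl

  open Walks (A m)

  walkWeight-A : ∀ f k → IsWalk f k → walkWeight f k ≡ just (sum< (suc k) (λ t → numZeros (proj₁ (f (suc t)))))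
  walkWeight-A f zero arcs = trans (A-arc (f 0) (f 1) (arcs 0 z≤n)) (cong just (sym (+-identityʳ _)))
  walkWeight-A f (suc k) arcs
    rewrite walkWeight-A f k (λ t t≤k → arcs t (m≤n⇒m≤1+n t≤k))
          | A-arc (f (suc k)) (f (suc (suc k))) (arcs (suc k) ≤-refl) =
    cong just (sym (sum<-suc (suc k) (λ t → numZeros (proj₁ (f (suc t))))))

  walkWeight-A⁻ : ∀ f k {x} → walkWeight f k ≡ just x →
    IsWalk f k × x ≡ sum< (suc k) (λ t → numZeros (proj₁ (f (suc t))))
  walkWeight-A⁻ f zero e with A-just (f 0) (f 1) e
  ... | arc , x≡ = (λ { zero _ → arc }) , trans x≡ (sym (+-identityʳ _))
  walkWeight-A⁻ f (suc k) e with +∞-just (walkWeight f k) (A m (f (suc k)) (f (suc (suc k)))) e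
  ... | a , b , ea , eb , refl with walkWeight-A⁻ f k ea | A-just (f (suc k)) (f (suc (suc k))) eb
  ... | arcs , a≡ | arc , b≡ =
    arcs′ , trans (cong₂ _+_ a≡ b≡) (sym (sum<-suc (suc k) (λ t → numZeros (proj₁ (f (suc t))))))
    where
    arcs′ : IsWalk f (suc k)
    arcs′ t t≤ with m≤n⇒m<n∨m≡n t≤
    ... | inj₁ (s≤s t≤k) = arcs t t≤k
    ... | inj₂ refl = arc

zeroWord : ∀ m → Word m
zeroWord m = tabulateℕ m (λ _ → l0)

correct-zeroWord : ∀ m → correct (zeroWord m) ≡ true
correct-zeroWord m =
  correct-canFollow (zeroWord m) (zeroWord m) (localAt⇒followsL m nothing (λ _ → l0) (λ _ → l0) (λ _ _ → refl))

vertexOf : ∀ {m} → Word m → V m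
vertexOf {m} w with T? (correct w)
... | yes c = w , c
... | no _ = zeroWord m , subst T (sym (correct-zeroWord m)) _

vertexOf-correct : ∀ {m} (w : Word m) → correct w ≡ true → proj₁ (vertexOf w) ≡ w
vertexOf-correct w e with T? (correct w)
... | yes _ = refl
... | no ¬c = ⊥-elim (¬c (subst T (sym e) _))

-- 2-dominating sets versus closed walks

module FromDominatingSet {k m : ℕ} (S : VSubset m (3 + k)) (dom : TwoDominating S) where

  open Cycle k
  open NeighbourCount S
  open Walks (A m)

  dominated : ∀ x y → x < m → y < n → s x y ≡ false → 2 ≤ nbrsExceptNext x y + σ x (cycSuc y)
  dominated x y x<m y<n ∉S = subst (2 ≤_) count (dom i j (trans (sym (memℕ-toℕ S i j)) ∉S′))
    where
    i : Fin m
    i = fromℕ< x<m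
    j : Fin n
    j = fromℕ< y<n
    ∉S′ : s (toℕ i) (toℕ j) ≡ false
    ∉S′ rewrite toℕ-fromℕ< x<m | toℕ-fromℕ< y<n = ∉S
    count : nbrsIn S (i , j) ≡ nbrsExceptNext x y + σ x (cycSuc y)
    count rewrite nbrsIn≡ i j | toℕ-fromℕ< x<m | toℕ-fromℕ< y<n = refl

  letter : ℕ → ℕ → Letter
  letter x y = vertexLetter (s x y) (nbrsExceptNext x y)

  column : ℕ → Word m
  column y = tabulateℕ m (λ x → letter x y)

  localAt-column : ∀ y → y < n → ∀ x → x < m →
    localAt m nothing (λ x → letter x (cycPred y)) (λ x → letter x y) x ≡ true
  localAt-column y y<n x x<m = begin
    localAt m nothing (λ x → letter x (cycPred y)) (λ x → letter x y) x
      ≡⟨ localAt≡localCond m (λ x → letter x y) (λ a → σ a y) (λ a _ → zeroCount-vertexLetter (s a y) _)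
                           (λ a → σ-row a y) (λ x → letter x (cycPred y)) x x<m ⟩
    localCond (before (λ a → σ a y) x + σ (suc x) y + zeroCount (just (letter x (cycPred y))))
              (letter x (cycPred y)) (letter x y)
      ≡⟨ cong (λ z → localCond (before (λ a → σ a y) x + σ (suc x) y + z) (letter x (cycPred y)) (letter x y))
              (zeroCount-vertexLetter (s x (cycPred y)) _) ⟩
    localCond (nbrsExceptNext x y) (letter x (cycPred y)) (letter x y)
      ≡⟨ localCond-vertexLetter (s x y) (nbrsExceptNext x y) (s x (cycSuc y))
                                (s x (cycPred y)) (nbrsExceptNext x (cycPred y))
                                (dominated x y x<m y<n) dominated-prev ⟩
    true ∎
    where
    open ≡-Reasoning
    dominated-prev : s x (cycPred y) ≡ false → 2 ≤ nbrsExceptNext x (cycPred y) + σ x y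
    dominated-prev ∉S = subst (λ z → 2 ≤ nbrsExceptNext x (cycPred y) + σ x z) (cycSuc-cycPred y y<n)
                              (dominated x (cycPred y) x<m (cycPred-< y y<n) ∉S)

  canFollow-column : ∀ y → y < n → canFollow (column (cycPred y)) (column y) ≡ true
  canFollow-column y y<n =
    localAt⇒followsL m nothing (λ x → letter x (cycPred y)) (λ x → letter x y) (localAt-column y y<n)

  column-correct : ∀ y → y < n → proj₁ (vertexOf (column y)) ≡ column y
  column-correct y y<n =
    vertexOf-correct (column y) (correct-canFollow (column (cycPred y)) (column y) (canFollow-column y y<n))

  -- walk 0 and walk n are both column (n ∸ 1), so the walk is closed by definition.
  walk : ℕ → V m
  walk t = vertexOf (column (cycPred t))

  isWalk : IsWalk walk (suc (suc k))
  isWalk t t≤ = subst₂ (λ q p → canFollow q p ≡ true)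
                        (sym (column-correct (cycPred t) (cycPred-< t (s≤s t≤))))
                        (sym (column-correct t (s≤s t≤)))
                        (canFollow-column t (s≤s t≤))

  walk-weight : sum< n (λ t → numZeros (proj₁ (walk (suc t)))) ≡ size S
  walk-weight = begin
    sum< n (λ t → numZeros (proj₁ (walk (suc t))))
      ≡⟨ sum<-cong n (λ y y<n → trans (cong numZeros (column-correct y y<n))
                                      (trans (numZeros-tabulateℕ m (λ x → letter x y))
                                             (sum<-cong m (λ x _ → cong ind (is0-vertexLetter (s x y) _))))) ⟩
    sum< n (λ y → sum< m (λ x → σ x y))
      ≡⟨ sym (sum<-swap m n σ) ⟩
    sum< m (λ x → sum< n (λ y → σ x y))
      ≡⟨ sym (size≡sum< S s (λ a b → sym (memℕ-toℕ S a b))) ⟩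
    size S ∎
    where open ≡-Reasoning

  minDiag-≤-size : Σ ℕ λ x → minDiag (A m ^ n) ≡ just x × x ≤ size S
  minDiag-≤-size = minDiag-≤-closedWalk (suc (suc k)) walk refl
                     (trans (walkWeight-A walk (suc (suc k)) isWalk) (cong just walk-weight))

module FromClosedWalk {k m : ℕ} (f : ℕ → V m) (closed : f (3 + k) ≡ f 0) {w : ℕ}
                      (weight : Walks.walkWeight (A m) f (suc (suc k)) ≡ just w) where

  open Cycle k

  isWalk : IsWalk f (suc (suc k))
  isWalk = proj₁ (walkWeight-A⁻ f (suc (suc k)) weight)

  -- Column y is step y + 1 of the walk; step 0 is column n ∸ 1 once more.
  column : ℕ → Word m
  column y = proj₁ (f (suc y))

  canFollow-column : ∀ y → y < n → canFollow (column (cycPred y)) (column y) ≡ true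
  canFollow-column zero _ = subst (λ v → canFollow (proj₁ v) (column 0) ≡ true) (sym closed) (isWalk 0 z≤n)
  canFollow-column (suc y) sy<n = isWalk (suc y) (≤-pred sy<n)

  letter : ℕ → ℕ → Letter
  letter x y = lookupℕ (column y) x

  S : VSubset m n
  S a b = is0 (letter (toℕ a) (toℕ b))

  open NeighbourCount S

  σ≡zeroCount : ∀ x y → x < m → y < n → σ x y ≡ zeroCount (just (letter x y))
  σ≡zeroCount x y x<m y<n = trans (cong ind (memℕ-∘toℕ (λ x y → is0 (letter x y)) x y x<m y<n))
                         (sym (zeroCount≡ind-is0 (letter x y)))

  size-S : size S ≡ w
  size-S = begin
    size S
      ≡⟨ size≡sum< S (λ x y → is0 (letter x y)) (λ a b → refl) ⟩
    sum< m (λ x → sum< n (λ y → ind (is0 (letter x y))))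
      ≡⟨ sum<-swap m n (λ x y → ind (is0 (letter x y))) ⟩
    sum< n (λ y → sum< m (λ x → ind (is0 (letter x y))))
      ≡⟨ sum<-cong n (λ y _ → sym (trans (cong numZeros (sym (tabulateℕ-lookupℕ (column y))))
                                        (numZeros-tabulateℕ m (lookupℕ (column y))))) ⟩
    sum< n (λ y → numZeros (column y))
      ≡⟨ sym (proj₂ (walkWeight-A⁻ f (suc (suc k)) weight)) ⟩
    w ∎
    where open ≡-Reasoning

  localCond-column : ∀ y → y < n → ∀ x → x < m →
    localCond (nbrsExceptNext x y) (letter x (cycPred y)) (letter x y) ≡ true
  localCond-column y y<n x x<m = begin
    localCond (nbrsExceptNext x y) (letter x (cycPred y)) (letter x y)
      ≡⟨ cong (λ z → localCond (before (λ a → σ a y) x + σ (suc x) y + z) (letter x (cycPred y)) (letter x y))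
              (σ≡zeroCount x (cycPred y) x<m (cycPred-< y y<n)) ⟩
    localCond (before (λ a → σ a y) x + σ (suc x) y + zeroCount (just (letter x (cycPred y))))
              (letter x (cycPred y)) (letter x y)
      ≡⟨ sym (localAt≡localCond m (λ a → letter a y) (λ a → σ a y)
                                (λ a a<m → sym (σ≡zeroCount a y a<m y<n))
                                (λ a → σ-row a y) (λ a → letter a (cycPred y)) x x<m) ⟩
    localAt m nothing (λ a → letter a (cycPred y)) (λ a → letter a y) x
      ≡⟨ canFollow⇒localAt (column (cycPred y)) (column y) (canFollow-column y y<n) x x<m ⟩
    true ∎
    where open ≡-Reasoning

  two⇒next∈S : ∀ x y → x < m → y < n → letter x y ≡ l2 → 1 ≤ σ x (cycSuc y)
  two⇒next∈S x y x<m y<n two =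
    subst (1 ≤_) (sym (trans (σ≡zeroCount x (cycSuc y) x<m (cycSuc-< y y<n))
                             (cong (λ l → zeroCount (just l)) next-zero)))
          ≤-refl
    where
    next-zero : letter x (cycSuc y) ≡ l0
    next-zero = localCond-2⇒0 (nbrsExceptNext x (cycSuc y)) (letter x (cycSuc y))
      (subst (λ l → localCond (nbrsExceptNext x (cycSuc y)) l (letter x (cycSuc y)) ≡ true)
             (trans (cong (letter x) (cycPred-cycSuc y y<n)) two)
             (localCond-column (cycSuc y) (cycSuc-< y y<n) x x<m))

  dominating : TwoDominating S
  dominating i j ∉S = subst (2 ≤_) (sym (nbrsIn≡ i j))
    (localCond-dominated (nbrsExceptNext x y) (letter x (cycPred y)) (letter x y) (σ x (cycSuc y))
       ∉S (localCond-column y y<n x x<m) (two⇒next∈S x y x<m y<n))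
    where
    x y : ℕ
    x = toℕ i
    y = toℕ j
    x<m : x < m
    x<m = toℕ<n i
    y<n : y < n
    y<n = toℕ<n j

-- The whole vertex set is 2-dominating, so some closed walk of length n exists.
minDiag-just : ∀ k m → Σ ℕ λ γ → minDiag (A m ^ (3 + k)) ≡ just γ
minDiag-just k m = map₂ proj₁ (FromDominatingSet.minDiag-≤-size {k} {m} (λ _ _ → true) (λ _ _ ()))

minDiag-optimal : ∀ k m {γ} → minDiag (A m ^ (3 + k)) ≡ just γ →
  (S : VSubset m (3 + k)) → TwoDominating S → γ ≤ size S
minDiag-optimal k m minDiag≡γ S dom =
  let (γ′ , minDiag≡γ′ , γ′≤) = FromDominatingSet.minDiag-≤-size S dom
  in subst (_≤ size S) (just-injective (trans (sym minDiag≡γ′) minDiag≡γ)) γ′≤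

theorem2 : (m n : ℕ) → 2 ≤ m → 3 ≤ n →
    Σ ℕ (λ k → minDiag (A m ^ n) ≡ just k × IsGamma2 m n k)
theorem2 m (suc (suc (suc k))) _ (s≤s (s≤s (s≤s _))) =
  let (γ , minDiag≡γ) = minDiag-just k m
      (f , closed , weight) = Walks.closedWalk-minDiag (A m) (suc (suc k)) minDiag≡γ
      open FromClosedWalk f closed weight
  in γ , minDiag≡γ , (S , dominating , size-S) , minDiag-optimal k m minDiag≡γ
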